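{- Let $\mathbb{F}$ be a field and let $i,j,d_1,d_2\in\mathbb{N}$ with $\mathrm{char}(\mathbb{F})>\max(i,j)$, and put $d=id_1+jd_2$. Then $$\mathbb{F}[x]^{\le d}=\mathrm{span}\{f^ig^j: f\in\mathbb{F}[x]^{\le d_1},\ g\in\mathbb{F}[x]^{\le d_2}\},$$ where $\mathbb{F}[x]^{\le k}$ denotes the set of polynomials over $\mathbb{F}$ of degree at most $k$. -}

module Defs where

open import Level using (Level; _⊔_)
open import Algebra.Bundles using (CommutativeRing)
open import Data.Nat using (ℕ; zero; suc; _<_; _≤_; _⊔_) renaming (_+_ to _+ℕ_; _*_ to _*ℕ_)
open import Data.Nat.Base using (_∸_)
open import Data.Product using (Σ; ∃; _×_; _,_)
open import Data.List using (List; []; _∷_)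
open import Relation.Nullary using (¬_)

-- Polynomials over a commutative ring R, represented by their coefficient
-- sequences  p : ℕ → Carrier  (p n = coefficient of x^n).
module Poly {c ℓ : Level} (R : CommutativeRing c ℓ) where
  open CommutativeRing R hiding (zero)

  record IsField : Set (c Level.⊔ ℓ) where
    field
      1≉0     : ¬ (1# ≈ 0#)
      inverse : ∀ x → ¬ (x ≈ 0#) → Σ Carrier (λ y → x * y ≈ 1#)

  ι : ℕ → Carrier
  ι zero    = 0#
  ι (suc n) = 1# + ι n

  -- char(R) > m : no k with 1 ≤ k ≤ m has k·1 = 0 (characteristic 0 included)
  CharGreaterThan : ℕ → Set ℓ
  CharGreaterThan m = ∀ k → 1 ≤ k → k ≤ m → ¬ (ι k ≈ 0#)

  Pol : Set c
  Pol = ℕ → Carrier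

  -- degree at most k (the zero polynomial has every degree bound)
  DegLe : ℕ → Pol → Set ℓ
  DegLe k p = ∀ n → k < n → p n ≈ 0#

  _≈P_ : Pol → Pol → Set ℓ
  p ≈P q = ∀ n → p n ≈ q n

  zeroP : Pol
  zeroP _ = 0#

  oneP : Pol
  oneP zero    = 1#
  oneP (suc _) = 0#

  _+P_ : Pol → Pol → Pol
  (p +P q) n = p n + q n

  _·P_ : Carrier → Pol → Pol
  (a ·P p) n = a * p n

  sumTo : ℕ → (ℕ → Carrier) → Carrier
  sumTo zero    f = f zero
  sumTo (suc n) f = sumTo n f + f (suc n)

  _*P_ : Pol → Pol → Pol
  (p *P q) n = sumTo n (λ m → p m * q (n ∸ m))

  _^P_ : Pol → ℕ → Pol
  p ^P zero  = oneP
  p ^P suc e = p *P (p ^P e)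

  combo : ℕ → ℕ → List (Carrier × Pol × Pol) → Pol
  combo i j []                  = zeroP
  combo i j ((a , f , g) ∷ ts) = (a ·P ((f ^P i) *P (g ^P j))) +P combo i j ts

  data AllDeg (d₁ d₂ : ℕ) : List (Carrier × Pol × Pol) → Set (c Level.⊔ ℓ) where
    []  : AllDeg d₁ d₂ []
    _∷_ : ∀ {a f g ts} → DegLe d₁ f × DegLe d₂ g → AllDeg d₁ d₂ ts → AllDeg d₁ d₂ ((a , f , g) ∷ ts)

  InSpan : ℕ → ℕ → ℕ → ℕ → Pol → Set (c Level.⊔ ℓ)
  InSpan i j d₁ d₂ h =
    Σ (List (Carrier × Pol × Pol)) λ ts → AllDeg d₁ d₂ ts × (h ≈P combo i j ts)

module Submission where

-- Every f^i g^j with deg f ≤ d₁ and deg g ≤ d₂ has degree at most d = i d₁ + j d₂; the work is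
-- the converse. The span is a subspace, so it suffices that it contains x^m for every m ≤ d.
-- Splitting m = m₁ + m₂ with m₁ ≤ i d₁ and m₂ ≤ j d₂, this follows by applying twice (to the
-- subspaces {p | p g^j ∈ span} and {q | x^m₁ q ∈ span}) a one-variable statement: a subspace
-- containing f^i for every f of degree ≤ d contains x^m for every m ≤ i d. For that, write
-- m = i a + k with a < d and k ≤ i. For every scalar t the subspace contains
--   (x^a + t x^(a+1))^i = Σₖ C(i,k) tᵏ x^(ia+k),
-- and evaluating at t = 0, 1, …, i and inverting the Vandermonde system isolates C(i,k) x^(ia+k).
-- The differences of these points are integers in [1, i] and C(i,k) divides i!, so all of them
-- are invertible when char 𝔽 > i.

open import Defs
open import Level using (Level) renaming (_⊔_ to _⊔ˡ_)
open import Algebra.Bundles using (CommutativeRing)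
open import Data.Nat using (ℕ; zero; suc; z≤n; s≤s; _∸_; _⊓_; _⊔_; _≤_; _<_; _!; _≤?_; _≟_)
  renaming (_+_ to _+ℕ_; _*_ to _*ℕ_)
import Data.Nat.Properties as ℕₚ
open import Data.Nat.Combinatorics
  using (_C_; k>n⇒nCk≡0; nCk≡n!/k![n-k]!; k![n∸k]!∣n!; nCk+nC[k+1]≡[n+1]C[k+1])
open import Data.Nat.Divisibility using (_∣_; divides; m/n∣m)
open import Data.Product using (Σ; _×_; _,_; proj₁; proj₂)
open import Data.List using ([]; _∷_; _++_; map)
open import Data.Empty using (⊥-elim)
open import Function using (_∘_)
open import Relation.Binary.PropositionalEquality as ≡ using (_≡_; _≢_)
open import Relation.Nullary using (¬_; yes; no)

nCk∣n! : ∀ {n k} → k ≤ n → n C k ∣ n !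
nCk∣n! {n} {k} k≤n = ≡.subst (_∣ n !) (≡.sym (nCk≡n!/k![n-k]! k≤n)) (m/n∣m (k![n∸k]!∣n! k≤n))
  where instance _ = k ℕₚ.!* (n ∸ k) !≢0

k≤n∧m≰n⇒k≢m : ∀ {k m n} → k ≤ n → ¬ m ≤ n → k ≢ m
k≤n∧m≰n⇒k≢m k≤n m≰n ≡.refl = m≰n k≤n

m≤n*[1+d]⇒m≡n*a+k : ∀ n d {m} → m ≤ n *ℕ suc d →
                    Σ ℕ λ a → Σ ℕ λ k → a ≤ d × k ≤ n × m ≡ n *ℕ a +ℕ k
m≤n*[1+d]⇒m≡n*a+k n zero {m} m≤n*1 =
  0 , m , z≤n , ≡.subst (m ≤_) (ℕₚ.*-identityʳ n) m≤n*1 , ≡.cong (_+ℕ m) (≡.sym (ℕₚ.*-zeroʳ n))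
m≤n*[1+d]⇒m≡n*a+k n (suc d) {m} m≤n*[2+d] with m ≤? n *ℕ suc d
... | yes m≤n*[1+d] =
  let a , k , a≤d , k≤n , m≡n*a+k = m≤n*[1+d]⇒m≡n*a+k n d m≤n*[1+d]
  in  a , k , ℕₚ.m≤n⇒m≤1+n a≤d , k≤n , m≡n*a+k
... | no m≰n*[1+d] =
  suc d , m ∸ n *ℕ suc d , ℕₚ.≤-refl ,
  ℕₚ.m≤n+o⇒m∸n≤o m (n *ℕ suc d) (≡.subst (m ≤_) n*[2+d]≡n*[1+d]+n m≤n*[2+d]) ,
  ≡.sym (ℕₚ.m+[n∸m]≡n (ℕₚ.<⇒≤ (ℕₚ.≰⇒> m≰n*[1+d])))
  where
  n*[2+d]≡n*[1+d]+n : n *ℕ suc (suc d) ≡ n *ℕ suc d +ℕ n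
  n*[2+d]≡n*[1+d]+n = ≡.trans (ℕₚ.*-suc n (suc d)) (ℕₚ.+-comm n _)

module _ {c ℓ : Level} (R : CommutativeRing c ℓ) where
  open CommutativeRing R hiding (zero)
  open Poly R
  open import Algebra.Properties.Semiring.Exp semiring using (_^_)
  open import Algebra.Properties.Semiring.Mult semiring using (×-homo-+; ×1-homo-*) renaming (_×_ to _·ℕ_)
  open import Algebra.Properties.Ring ring using (-1*x≈-x; [y-z]x≈yx-zx)
  open import Algebra.Properties.AbelianGroup +-abelianGroup using (⁻¹-∙-comm)
  open import Algebra.Properties.Group +-group using (//-rightDividesʳ)
  open import Algebra.Solver.Ring.NaturalCoefficients.Default commutativeSemiring
    using (solve; _:+_; _:*_; _:=_; con)
  open import Relation.Binary.Reasoning.Setoid setoid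

  ι≈n·1# : ∀ n → ι n ≈ n ·ℕ 1#
  ι≈n·1# zero    = refl
  ι≈n·1# (suc n) = +-congˡ (ι≈n·1# n)

  ι-+ : ∀ m n → ι (m +ℕ n) ≈ ι m + ι n
  ι-+ m n = trans (ι≈n·1# (m +ℕ n)) (trans (×-homo-+ 1# m n) (sym (+-cong (ι≈n·1# m) (ι≈n·1# n))))

  ι-* : ∀ m n → ι (m *ℕ n) ≈ ι m * ι n
  ι-* m n = trans (ι≈n·1# (m *ℕ n)) (trans (×1-homo-* m n) (sym (*-cong (ι≈n·1# m) (ι≈n·1# n))))

  ι-∸ : ∀ {m n} → n ≤ m → ι m - ι n ≈ ι (m ∸ n)
  ι-∸ {m} {n} n≤m = begin
    ι m - ι n                ≈⟨ +-congʳ (reflexive (≡.cong ι (≡.sym (ℕₚ.m∸n+n≡m n≤m)))) ⟩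
    ι (m ∸ n +ℕ n) - ι n     ≈⟨ +-congʳ (ι-+ (m ∸ n) n) ⟩
    (ι (m ∸ n) + ι n) - ι n  ≈⟨ //-rightDividesʳ (ι n) (ι (m ∸ n)) ⟩
    ι (m ∸ n)                ∎

  ∣-resp-ι≈0 : ∀ {m n} → m ∣ n → ι m ≈ 0# → ι n ≈ 0#
  ∣-resp-ι≈0 {m} (divides q ≡.refl) ιm≈0 = begin
    ι (q *ℕ m)  ≈⟨ ι-* q m ⟩
    ι q * ι m   ≈⟨ *-congˡ ιm≈0 ⟩
    ι q * 0#    ≈⟨ zeroʳ (ι q) ⟩
    0#          ∎

  CharGreaterThan-mono : ∀ {m n} → m ≤ n → CharGreaterThan n → CharGreaterThan m
  CharGreaterThan-mono m≤n char k 1≤k k≤m = char k 1≤k (ℕₚ.≤-trans k≤m m≤n)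

  [x+z]-[y+z]≈x-y : ∀ x y z → (x + z) - (y + z) ≈ x - y
  [x+z]-[y+z]≈x-y x y z = begin
    (x + z) - (y + z)      ≈⟨ +-congˡ (⁻¹-∙-comm y z) ⟨
    (x + z) + (- y + - z)  ≈⟨ solve 4 (λ x z y′ z′ → (x :+ z) :+ (y′ :+ z′) := (x :+ y′) :+ (z :+ z′))
                                      refl x z (- y) (- z) ⟩
    (x - y) + (z - z)      ≈⟨ +-congˡ (-‿inverseʳ z) ⟩
    (x - y) + 0#           ≈⟨ +-identityʳ _ ⟩
    x - y                  ∎

  divide-by-difference : ∀ {a b x t τ y} → a + τ * x ≈ b + t * x → y * (t - τ) ≈ 1# → y * (a - b) ≈ x
  divide-by-difference {a} {b} {x} {t} {τ} {y} a+τx≈b+tx y[t-τ]≈1 = begin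
    y * (a - b)        ≈⟨ *-congˡ a-b≈[t-τ]x ⟩
    y * ((t - τ) * x)  ≈⟨ *-assoc y _ x ⟨
    (y * (t - τ)) * x  ≈⟨ *-congʳ y[t-τ]≈1 ⟩
    1# * x             ≈⟨ *-identityˡ x ⟩
    x                  ∎
    where
    a-b≈[t-τ]x : a - b ≈ (t - τ) * x
    a-b≈[t-τ]x = begin
      a - b                      ≈⟨ [x+z]-[y+z]≈x-y a b (τ * x) ⟨
      (a + τ * x) - (b + τ * x)  ≈⟨ +-congʳ a+τx≈b+tx ⟩
      (b + t * x) - (b + τ * x)  ≈⟨ +-cong (+-comm b _) (-‿cong (+-comm b _)) ⟩
      (t * x + b) - (τ * x + b)  ≈⟨ [x+z]-[y+z]≈x-y (t * x) (τ * x) b ⟩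
      t * x - τ * x              ≈⟨ [y-z]x≈yx-zx x t τ ⟨
      (t - τ) * x                ∎

  Invertible : Carrier → Set (c ⊔ˡ ℓ)
  Invertible x = Σ Carrier λ y → y * x ≈ 1#

  module _ (isField : IsField) where
    open IsField isField

    ≉0⇒invertible : ∀ {x} → ¬ x ≈ 0# → Invertible x
    ≉0⇒invertible {x} x≉0 = let y , xy≈1 = inverse x x≉0 in y , trans (*-comm y x) xy≈1

    *-≉0 : ∀ {x y} → ¬ x ≈ 0# → ¬ y ≈ 0# → ¬ x * y ≈ 0#
    *-≉0 {x} {y} x≉0 y≉0 xy≈0 = y≉0 (begin
      y            ≈⟨ *-identityˡ y ⟨
      1# * y       ≈⟨ *-congʳ zx≈1 ⟨
      (z * x) * y  ≈⟨ *-assoc z x y ⟩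
      z * (x * y)  ≈⟨ *-congˡ xy≈0 ⟩
      z * 0#       ≈⟨ zeroʳ z ⟩
      0#           ∎)
      where
      z    = proj₁ (≉0⇒invertible x≉0)
      zx≈1 = proj₂ (≉0⇒invertible x≉0)

    ι[n!]≉0 : ∀ {m} → CharGreaterThan m → ∀ n → n ≤ m → ¬ ι (n !) ≈ 0#
    ι[n!]≉0 char zero    _     ι1≈0 = 1≉0 (trans (sym (+-identityʳ 1#)) ι1≈0)
    ι[n!]≉0 char (suc n) 1+n≤m ι≈0  =
      *-≉0 (char (suc n) (s≤s z≤n) 1+n≤m) (ι[n!]≉0 char n (ℕₚ.≤-trans (ℕₚ.n≤1+n n) 1+n≤m))
           (trans (sym (ι-* (suc n) (n !))) ι≈0)

    ι[nCk]≉0 : ∀ {n} → CharGreaterThan n → ∀ k → k ≤ n → ¬ ι (n C k) ≈ 0#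
    ι[nCk]≉0 {n} char k k≤n = ι[n!]≉0 char n ℕₚ.≤-refl ∘ ∣-resp-ι≈0 (nCk∣n! k≤n)

    ι-differences-invertible : ∀ {n} → CharGreaterThan n →
                               ∀ r s → r < s → s ≤ n → Invertible (ι s - ι r)
    ι-differences-invertible char r s r<s s≤n =
      let y , yι≈1 = ≉0⇒invertible (char (s ∸ r) (ℕₚ.m<n⇒0<n∸m r<s) s∸r≤n)
      in  y , trans (*-congˡ (ι-∸ (ℕₚ.<⇒≤ r<s))) yι≈1
      where s∸r≤n = ℕₚ.≤-trans (ℕₚ.m∸n≤m s r) s≤n

  sumTo-cong : ∀ n {F G : ℕ → Carrier} → (∀ m → m ≤ n → F m ≈ G m) → sumTo n F ≈ sumTo n G
  sumTo-cong zero    F≈G = F≈G 0 z≤n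
  sumTo-cong (suc n) F≈G =
    +-cong (sumTo-cong n (λ m m≤n → F≈G m (ℕₚ.m≤n⇒m≤1+n m≤n))) (F≈G (suc n) ℕₚ.≤-refl)

  sumTo-+ : ∀ n (F G : ℕ → Carrier) → sumTo n (λ m → F m + G m) ≈ sumTo n F + sumTo n G
  sumTo-+ zero    F G = refl
  sumTo-+ (suc n) F G = trans (+-congʳ (sumTo-+ n F G))
    (solve 4 (λ a b x y → (a :+ b) :+ (x :+ y) := (a :+ x) :+ (b :+ y)) refl _ _ _ _)

  sumTo-*ˡ : ∀ n a (F : ℕ → Carrier) → sumTo n (λ m → a * F m) ≈ a * sumTo n F
  sumTo-*ˡ zero    a F = refl
  sumTo-*ˡ (suc n) a F = trans (+-congʳ (sumTo-*ˡ n a F)) (sym (distribˡ a _ _))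

  sumTo-zero : ∀ n (F : ℕ → Carrier) → (∀ m → m ≤ n → F m ≈ 0#) → sumTo n F ≈ 0#
  sumTo-zero zero    F F≈0 = F≈0 0 z≤n
  sumTo-zero (suc n) F F≈0 = trans
    (+-cong (sumTo-zero n F (λ m m≤n → F≈0 m (ℕₚ.m≤n⇒m≤1+n m≤n))) (F≈0 (suc n) ℕₚ.≤-refl))
    (+-identityʳ 0#)

  sumTo-singleton : ∀ n a (F : ℕ → Carrier) → a ≤ n → (∀ m → m ≤ n → m ≢ a → F m ≈ 0#) →
                    sumTo n F ≈ F a
  sumTo-singleton zero    .zero F z≤n _ = refl
  sumTo-singleton (suc n) a     F a≤1+n F≈0 with a ≟ suc n
  ... | yes ≡.refl = trans
    (+-congʳ (sumTo-zero n F (λ m m≤n → F≈0 m (ℕₚ.m≤n⇒m≤1+n m≤n) (ℕₚ.<⇒≢ (s≤s m≤n)))))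
    (+-identityˡ _)
  ... | no  a≢1+n  = trans
    (+-cong (sumTo-singleton n a F (ℕₚ.≤-pred (ℕₚ.≤∧≢⇒< a≤1+n a≢1+n))
                                   (λ m m≤n → F≈0 m (ℕₚ.m≤n⇒m≤1+n m≤n)))
            (F≈0 (suc n) ℕₚ.≤-refl (a≢1+n ∘ ≡.sym)))
    (+-identityʳ _)

  ≈P-sym : ∀ {p q} → p ≈P q → q ≈P p
  ≈P-sym p≈q n = sym (p≈q n)

  ≈P-trans : ∀ {p q r} → p ≈P q → q ≈P r → p ≈P r
  ≈P-trans p≈q q≈r n = trans (p≈q n) (q≈r n)

  x^ : ℕ → Pol
  x^ zero    zero    = 1#
  x^ zero    (suc n) = 0#
  x^ (suc k) zero    = 0#
  x^ (suc k) (suc n) = x^ k n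

  x^-diag : ∀ k → x^ k k ≈ 1#
  x^-diag zero    = refl
  x^-diag (suc k) = x^-diag k

  x^-off : ∀ {k n} → k ≢ n → x^ k n ≈ 0#
  x^-off {zero}  {zero}  k≢n = ⊥-elim (k≢n ≡.refl)
  x^-off {zero}  {suc n} _   = refl
  x^-off {suc k} {zero}  _   = refl
  x^-off {suc k} {suc n} k≢n = x^-off (k≢n ∘ ≡.cong suc)

  oneP≈x^0 : oneP ≈P x^ 0
  oneP≈x^0 zero    = refl
  oneP≈x^0 (suc n) = refl

  shift : ℕ → Pol → Pol
  shift zero    p n       = p n
  shift (suc a) p zero    = 0#
  shift (suc a) p (suc n) = shift a p n

  shift-≥ : ∀ a p {n} → a ≤ n → shift a p n ≈ p (n ∸ a)
  shift-≥ zero    p         _         = refl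
  shift-≥ (suc a) p {suc n} (s≤s a≤n) = shift-≥ a p a≤n

  shift-< : ∀ a p {n} → n < a → shift a p n ≈ 0#
  shift-< (suc a) p {zero}  _         = refl
  shift-< (suc a) p {suc n} (s≤s n<a) = shift-< a p n<a

  shift-cong : ∀ a {p q} → p ≈P q → shift a p ≈P shift a q
  shift-cong zero    p≈q n       = p≈q n
  shift-cong (suc a) p≈q zero    = refl
  shift-cong (suc a) p≈q (suc n) = shift-cong a p≈q n

  shift-+P : ∀ a p q → shift a (p +P q) ≈P (shift a p +P shift a q)
  shift-+P zero    p q n       = refl
  shift-+P (suc a) p q zero    = sym (+-identityʳ 0#)
  shift-+P (suc a) p q (suc n) = shift-+P a p q n

  shift-·P : ∀ a b p → shift a (b ·P p) ≈P (b ·P shift a p)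
  shift-·P zero    b p n       = refl
  shift-·P (suc a) b p zero    = sym (zeroʳ b)
  shift-·P (suc a) b p (suc n) = shift-·P a b p n

  shift-shift : ∀ a b p → shift a (shift b p) ≈P shift (a +ℕ b) p
  shift-shift zero    b p n       = refl
  shift-shift (suc a) b p zero    = refl
  shift-shift (suc a) b p (suc n) = shift-shift a b p n

  shift-suc : ∀ a p → shift (suc a) p ≈P shift a (shift 1 p)
  shift-suc zero    p n       = refl
  shift-suc (suc a) p zero    = refl
  shift-suc (suc a) p (suc n) = shift-suc a p n

  shift-x^ : ∀ a k → shift a (x^ k) ≈P x^ (a +ℕ k)
  shift-x^ zero    k n       = refl
  shift-x^ (suc a) k zero    = refl
  shift-x^ (suc a) k (suc n) = shift-x^ a k n

  x^*P≈shift : ∀ a p → (x^ a *P p) ≈P shift a p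
  x^*P≈shift a p n with a ≤? n
  ... | yes a≤n = begin
    sumTo n (λ m → x^ a m * p (n ∸ m))  ≈⟨ sumTo-singleton n a _ a≤n (λ m _ m≢a → term≈0 (m≢a ∘ ≡.sym)) ⟩
    x^ a a * p (n ∸ a)                  ≈⟨ trans (*-congʳ (x^-diag a)) (*-identityˡ _) ⟩
    p (n ∸ a)                           ≈⟨ shift-≥ a p a≤n ⟨
    shift a p n                         ∎
    where
    term≈0 : ∀ {m} → a ≢ m → x^ a m * p (n ∸ m) ≈ 0#
    term≈0 a≢m = trans (*-congʳ (x^-off a≢m)) (zeroˡ _)
  ... | no a≰n = trans
    (sumTo-zero n _ (λ m m≤n → trans (*-congʳ (x^-off (k≤n∧m≰n⇒k≢m m≤n a≰n ∘ ≡.sym))) (zeroˡ _)))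
    (sym (shift-< a p (ℕₚ.≰⇒> a≰n)))

  x^0-^P : ∀ i → (x^ 0 ^P i) ≈P x^ 0
  x^0-^P zero    = oneP≈x^0
  x^0-^P (suc i) = ≈P-trans (x^*P≈shift 0 (x^ 0 ^P i)) (x^0-^P i)

  *P-congˡ : ∀ p {q q′} → q ≈P q′ → (p *P q) ≈P (p *P q′)
  *P-congˡ p q≈q′ n = sumTo-cong n (λ m _ → *-congˡ (q≈q′ (n ∸ m)))

  *P-congʳ : ∀ q {p p′} → p ≈P p′ → (p *P q) ≈P (p′ *P q)
  *P-congʳ q p≈p′ n = sumTo-cong n (λ m _ → *-congʳ (p≈p′ m))

  *P-distribˡ : ∀ p q q′ → (p *P (q +P q′)) ≈P ((p *P q) +P (p *P q′))
  *P-distribˡ p q q′ n = trans (sumTo-cong n (λ m _ → distribˡ _ _ _)) (sumTo-+ n _ _)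

  *P-distribʳ : ∀ q p p′ → ((p +P p′) *P q) ≈P ((p *P q) +P (p′ *P q))
  *P-distribʳ q p p′ n = trans (sumTo-cong n (λ m _ → distribʳ _ _ _)) (sumTo-+ n _ _)

  ·P-*P-assoc : ∀ a p q → ((a ·P p) *P q) ≈P (a ·P (p *P q))
  ·P-*P-assoc a p q n = trans (sumTo-cong n (λ m _ → *-assoc _ _ _)) (sumTo-*ˡ n a _)

  *P-·P-comm : ∀ a p q → (p *P (a ·P q)) ≈P (a ·P (p *P q))
  *P-·P-comm a p q n = trans
    (sumTo-cong n (λ m _ → solve 3 (λ x y z → y :* (x :* z) := x :* (y :* z)) refl a _ _))
    (sumTo-*ˡ n a _)

  DegLe-resp : ∀ {k p q} → p ≈P q → DegLe k p → DegLe k q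
  DegLe-resp p≈q deg n k<n = trans (sym (p≈q n)) (deg n k<n)

  DegLe-mono : ∀ {k k′ p} → k ≤ k′ → DegLe k p → DegLe k′ p
  DegLe-mono k≤k′ deg n k′<n = deg n (ℕₚ.≤-<-trans k≤k′ k′<n)

  DegLe-x^ : ∀ k → DegLe k (x^ k)
  DegLe-x^ k n k<n = x^-off (ℕₚ.<⇒≢ k<n)

  DegLe-+P : ∀ {k p q} → DegLe k p → DegLe k q → DegLe k (p +P q)
  DegLe-+P deg-p deg-q n k<n = trans (+-cong (deg-p n k<n) (deg-q n k<n)) (+-identityʳ 0#)

  DegLe-·P : ∀ {k p} a → DegLe k p → DegLe k (a ·P p)
  DegLe-·P a deg n k<n = trans (*-congˡ (deg n k<n)) (zeroʳ a)

  DegLe-*P : ∀ {a b p q} → DegLe a p → DegLe b q → DegLe (a +ℕ b) (p *P q)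
  DegLe-*P {a} {b} {p} {q} deg-p deg-q n a+b<n = sumTo-zero n _ term≈0
    where
    term≈0 : ∀ m → m ≤ n → p m * q (n ∸ m) ≈ 0#
    term≈0 m m≤n with m ≤? a
    ... | yes m≤a = trans (*-congˡ (deg-q (n ∸ m) b<n∸m)) (zeroʳ _)
      where
      b<n∸m : b < n ∸ m
      b<n∸m = ℕₚ.m+n≤o⇒m≤o∸n (suc b) (ℕₚ.≤-trans (s≤s b+m≤a+b) a+b<n)
        where b+m≤a+b = ℕₚ.≤-trans (ℕₚ.+-monoʳ-≤ b m≤a) (ℕₚ.≤-reflexive (ℕₚ.+-comm b a))
    ... | no m≰a = trans (*-congʳ (deg-p m (ℕₚ.≰⇒> m≰a))) (zeroˡ _)

  DegLe-^P : ∀ {a p} k → DegLe a p → DegLe (k *ℕ a) (p ^P k)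
  DegLe-^P zero    deg (suc n) _ = refl
  DegLe-^P (suc k) deg           = DegLe-*P deg (DegLe-^P k deg)

  DegLe-x^+x^suc : ∀ a t → DegLe (suc a) (x^ a +P (t ·P x^ (suc a)))
  DegLe-x^+x^suc a t = DegLe-+P (DegLe-mono (ℕₚ.n≤1+n a) (DegLe-x^ a)) (DegLe-·P t (DegLe-x^ (suc a)))

  linComb : ℕ → (ℕ → Carrier) → (ℕ → Pol) → Pol
  linComb zero    a p = a 0 ·P p 0
  linComb (suc n) a p = linComb n a p +P (a (suc n) ·P p (suc n))

  linComb-·P : ∀ n (a b : ℕ → Carrier) (p : ℕ → Pol) →
               linComb n a (λ k → b k ·P p k) ≈P linComb n (λ k → a k * b k) p
  linComb-·P zero    a b p m = sym (*-assoc _ _ _)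
  linComb-·P (suc n) a b p m = +-cong (linComb-·P n a b p m) (sym (*-assoc _ _ _))

  linComb-coeff : ∀ n a p m → linComb n a p m ≈ sumTo n (λ k → a k * p k m)
  linComb-coeff zero    a p m = refl
  linComb-coeff (suc n) a p m = +-congʳ (linComb-coeff n a p m)

  linComb-x^-≤ : ∀ N a {m} → m ≤ N → linComb N a x^ m ≈ a m
  linComb-x^-≤ N a {m} m≤N = begin
    linComb N a x^ m              ≈⟨ linComb-coeff N a x^ m ⟩
    sumTo N (λ k → a k * x^ k m)  ≈⟨ sumTo-singleton N m _ m≤N (λ k _ k≢m → term≈0 k≢m) ⟩
    a m * x^ m m                  ≈⟨ trans (*-congˡ (x^-diag m)) (*-identityʳ _) ⟩
    a m                           ∎
    where
    term≈0 : ∀ {k} → k ≢ m → a k * x^ k m ≈ 0#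
    term≈0 k≢m = trans (*-congˡ (x^-off k≢m)) (zeroʳ _)

  linComb-x^-≰ : ∀ N a {m} → ¬ m ≤ N → linComb N a x^ m ≈ 0#
  linComb-x^-≰ N a {m} m≰N = trans (linComb-coeff N a x^ m)
    (sumTo-zero N _ (λ k k≤N → trans (*-congˡ (x^-off (k≤n∧m≰n⇒k≢m k≤N m≰N))) (zeroʳ _)))

  DegLe⇒≈linComb-x^ : ∀ {N h} → DegLe N h → h ≈P linComb N h x^
  DegLe⇒≈linComb-x^ {N} {h} deg m with m ≤? N
  ... | yes m≤N = sym (linComb-x^-≤ N h m≤N)
  ... | no  m≰N = trans (deg m (ℕₚ.≰⇒> m≰N)) (sym (linComb-x^-≰ N h m≰N))

  -- eval n c t = Σₖ₌₀ⁿ tᵏ cₖ : a polynomial in an auxiliary variable, with coefficients cₖ ∈ 𝔽[x],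
  -- evaluated at the scalar t.
  eval : ℕ → (ℕ → Pol) → Carrier → Pol
  eval n c t = linComb n (t ^_) c

  eval-horner : ∀ n c t → eval (suc n) c t ≈P (c 0 +P (t ·P eval n (c ∘ suc) t))
  eval-horner zero    c t m =
    solve 3 (λ t c₀ c₁ → con 1 :* c₀ :+ (t :* con 1) :* c₁ := c₀ :+ t :* (con 1 :* c₁)) refl t (c 0 m) (c 1 m)
  eval-horner (suc n) c t m = begin
    eval (suc n) c t m + (t * t ^ suc n) * c (2 +ℕ n) m
      ≈⟨ +-congʳ (eval-horner n c t m) ⟩
    (c 0 m + t * eval n (c ∘ suc) t m) + (t * t ^ suc n) * c (2 +ℕ n) m
      ≈⟨ solve 5 (λ c₀ t e p c′ → (c₀ :+ t :* e) :+ (t :* p) :* c′ := c₀ :+ t :* (e :+ p :* c′))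
               refl (c 0 m) t (eval n (c ∘ suc) t m) (t ^ suc n) (c (2 +ℕ n) m) ⟩
    c 0 m + t * (eval n (c ∘ suc) t m + t ^ suc n * c (2 +ℕ n) m)
      ∎

  -- Synthetic division of eval (suc n) c by t − τ: for k ≤ n the k-th coefficient of the quotient
  -- is Σₗ τˡ c (k + 1 + l); the zeroP clause lies outside that range.
  synthDiv : ℕ → Carrier → (ℕ → Pol) → ℕ → Pol
  synthDiv n       τ c zero    = eval n (c ∘ suc) τ
  synthDiv zero    τ c (suc k) = zeroP
  synthDiv (suc n) τ c (suc k) = synthDiv n τ (c ∘ suc) k

  synthDiv-correct : ∀ n τ c t → (eval (suc n) c t +P (τ ·P eval n (synthDiv n τ c) t))
                                 ≈P (eval (suc n) c τ +P (t ·P eval n (synthDiv n τ c) t))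
  synthDiv-correct zero τ c t m =
    solve 4 (λ c₀ c₁ t τ → (con 1 :* c₀ :+ (t :* con 1) :* c₁) :+ τ :* (con 1 :* (con 1 :* c₁))
                         := (con 1 :* c₀ :+ (τ :* con 1) :* c₁) :+ t :* (con 1 :* (con 1 :* c₁)))
          refl (c 0 m) (c 1 m) t τ
  synthDiv-correct (suc n) τ c t m = begin
    eval (2 +ℕ n) c t m + τ * eval (suc n) Q t m
      ≈⟨ +-cong (eval-horner (suc n) c t m) (*-congˡ (eval-horner n Q t m)) ⟩
    (c 0 m + t * Pₜ) + τ * (A + t * B)
      ≈⟨ solve 6 (λ c₀ t Pₜ τ A B → (c₀ :+ t :* Pₜ) :+ τ :* (A :+ t :* B)
                                  := (c₀ :+ τ :* A) :+ t :* (Pₜ :+ τ :* B))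
               refl (c 0 m) t Pₜ τ A B ⟩
    (c 0 m + τ * A) + t * (Pₜ + τ * B)
      ≈⟨ +-congˡ (*-congˡ (synthDiv-correct n τ (c ∘ suc) t m)) ⟩
    (c 0 m + τ * A) + t * (A + t * B)
      ≈⟨ +-cong (eval-horner (suc n) c τ m) (*-congˡ (eval-horner n Q t m)) ⟨
    eval (2 +ℕ n) c τ m + t * eval (suc n) Q t m
      ∎
    where
    Q  = synthDiv (suc n) τ c
    Pₜ = eval (suc n) (c ∘ suc) t m
    A  = eval (suc n) (c ∘ suc) τ m
    B  = eval n (synthDiv n τ (c ∘ suc)) t m

  record IsSubspace {w} (W : Pol → Set w) : Set (c ⊔ˡ ℓ ⊔ˡ w) where
    field
      ∈-+P   : ∀ {p q} → W p → W q → W (p +P q)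
      ∈-·P   : ∀ a {p} → W p → W (a ·P p)
      ∈-resp : ∀ {p q} → p ≈P q → W p → W q

    ∈-− : ∀ {p q} → W p → W q → W (λ n → p n - q n)
    ∈-− Wp Wq = ∈-resp (λ n → +-congˡ (-1*x≈-x _)) (∈-+P Wp (∈-·P (- 1#) Wq))

  module _ {w} {W : Pol → Set w} (W-sub : IsSubspace W) where
    open IsSubspace W-sub

    shift-preimage : ∀ a → IsSubspace (W ∘ shift a)
    shift-preimage a = record
      { ∈-+P   = λ {p} {q} Wp Wq → ∈-resp (≈P-sym (shift-+P a p q)) (∈-+P Wp Wq)
      ; ∈-·P   = λ b {p} Wp → ∈-resp (≈P-sym (shift-·P a b p)) (∈-·P b Wp)
      ; ∈-resp = λ p≈q → ∈-resp (shift-cong a p≈q)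
      }

    *P-preimageˡ : ∀ p → IsSubspace (λ q → W (p *P q))
    *P-preimageˡ p = record
      { ∈-+P   = λ {q} {q′} Wq Wq′ → ∈-resp (≈P-sym (*P-distribˡ p q q′)) (∈-+P Wq Wq′)
      ; ∈-·P   = λ b {q} Wq → ∈-resp (≈P-sym (*P-·P-comm b p q)) (∈-·P b Wq)
      ; ∈-resp = λ q≈q′ → ∈-resp (*P-congˡ p q≈q′)
      }

    *P-preimageʳ : ∀ q → IsSubspace (λ p → W (p *P q))
    *P-preimageʳ q = record
      { ∈-+P   = λ {p} {p′} Wp Wp′ → ∈-resp (≈P-sym (*P-distribʳ q p p′)) (∈-+P Wp Wp′)
      ; ∈-·P   = λ b {p} Wp → ∈-resp (≈P-sym (·P-*P-assoc b p q)) (∈-·P b Wp)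
      ; ∈-resp = λ p≈p′ → ∈-resp (*P-congʳ q p≈p′)
      }

    ∈-linComb : ∀ n a p → (∀ k → k ≤ n → W (p k)) → W (linComb n a p)
    ∈-linComb zero    a p Wp = ∈-·P (a 0) (Wp 0 z≤n)
    ∈-linComb (suc n) a p Wp =
      ∈-+P (∈-linComb n a p (λ k k≤n → Wp k (ℕₚ.m≤n⇒m≤1+n k≤n)))
           (∈-·P (a (suc n)) (Wp (suc n) ℕₚ.≤-refl))

    x^∈⇒DegLe⇒∈ : ∀ {N h} → (∀ m → m ≤ N → W (x^ m)) → DegLe N h → W h
    x^∈⇒DegLe⇒∈ {N} {h} Wx^ deg = ∈-resp (≈P-sym (DegLe⇒≈linComb-x^ deg)) (∈-linComb N h x^ Wx^)

    ∈-quotient : ∀ n τ c {t y} → y * (t - τ) ≈ 1# →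
                 W (eval (suc n) c t) → W (eval (suc n) c τ) → W (eval n (synthDiv n τ c) t)
    ∈-quotient n τ c y[t-τ]≈1 Wₜ W_τ =
      ∈-resp (λ m → divide-by-difference (synthDiv-correct n τ c _ m) y[t-τ]≈1) (∈-·P _ (∈-− Wₜ W_τ))

    ∈-coefficients-of-quotient : ∀ n τ c → W (eval (suc n) c τ) → (∀ k → k ≤ n → W (synthDiv n τ c k)) →
                                 ∀ k → k ≤ suc n → W (c k)
    ∈-coefficients-of-quotient n τ c W_τ WQ zero _ =
      ∈-resp (λ m → trans (+-congʳ (eval-horner n c τ m)) (//-rightDividesʳ _ _))
             (∈-− W_τ (∈-·P τ (WQ 0 z≤n)))
    ∈-coefficients-of-quotient zero    τ c W_τ WQ (suc zero)    _      = ∈-resp (λ m → *-identityˡ _) (WQ 0 z≤n)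
    ∈-coefficients-of-quotient zero    τ c W_τ WQ (suc (suc k)) (s≤s ())
    ∈-coefficients-of-quotient (suc n) τ c W_τ WQ (suc k)       (s≤s k≤1+n) =
      ∈-coefficients-of-quotient n τ (c ∘ suc) (WQ 0 z≤n) (λ j j≤n → WQ (suc j) (s≤s j≤n)) k k≤1+n

    ∈-coefficients : ∀ n c (pts : ℕ → Carrier) → (∀ r s → r < s → s ≤ n → Invertible (pts s - pts r)) →
                     (∀ s → s ≤ n → W (eval n c (pts s))) → ∀ k → k ≤ n → W (c k)
    ∈-coefficients zero    c pts _   Wc _ z≤n = ∈-resp (λ m → *-identityˡ _) (Wc 0 z≤n)
    ∈-coefficients (suc n) c pts inv Wc =
      ∈-coefficients-of-quotient n (pts 0) c (Wc 0 z≤n)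
        (∈-coefficients n (synthDiv n (pts 0) c) (pts ∘ suc)
          (λ r s r<s s≤n → inv (suc r) (suc s) (s≤s r<s) (s≤s s≤n)) WQ)
      where
      WQ : ∀ s → s ≤ n → W (eval n (synthDiv n (pts 0) c) (pts (suc s)))
      WQ s s≤n = ∈-quotient n (pts 0) c (proj₂ (inv 0 (suc s) (s≤s z≤n) (s≤s s≤n)))
                            (Wc (suc s) (s≤s s≤n)) (Wc 0 z≤n)

  -- binomial i t is (1 + t x)^i
  binomial : ℕ → Carrier → Pol
  binomial i t n = ι (i C n) * t ^ n

  oneP≈binomial-zero : ∀ t → oneP ≈P binomial 0 t
  oneP≈binomial-zero t zero    = sym (trans (*-identityʳ _) (+-identityʳ 1#))
  oneP≈binomial-zero t (suc n) = sym (zeroˡ _)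

  binomial-suc : ∀ i t → binomial (suc i) t ≈P (binomial i t +P (t ·P shift 1 (binomial i t)))
  binomial-suc i t zero    = trans (sym (+-identityʳ _)) (+-congˡ (sym (zeroʳ t)))
  binomial-suc i t (suc m) = begin
    ι (suc i C suc m) * (t * t ^ m)
      ≈⟨ *-congʳ (reflexive (≡.cong ι (≡.sym (nCk+nC[k+1]≡[n+1]C[k+1] i m)))) ⟩
    ι (i C m +ℕ i C suc m) * (t * t ^ m)
      ≈⟨ *-congʳ (ι-+ (i C m) (i C suc m)) ⟩
    (ι (i C m) + ι (i C suc m)) * (t * t ^ m)
      ≈⟨ solve 4 (λ x y t p → (x :+ y) :* (t :* p) := y :* (t :* p) :+ t :* (x :* p))
               refl (ι (i C m)) (ι (i C suc m)) t (t ^ m) ⟩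
    ι (i C suc m) * (t * t ^ m) + t * (ι (i C m) * t ^ m)
      ∎

  binomial≈eval : ∀ i t → binomial i t ≈P eval i (λ k → ι (i C k) ·P x^ k) t
  binomial≈eval i t m with m ≤? i
  ... | yes m≤i = begin
    ι (i C m) * t ^ m                              ≈⟨ *-comm _ _ ⟩
    t ^ m * ι (i C m)                              ≈⟨ linComb-x^-≤ i _ m≤i ⟨
    linComb i (λ k → t ^ k * ι (i C k)) x^ m       ≈⟨ linComb-·P i (t ^_) _ x^ m ⟨
    eval i (λ k → ι (i C k) ·P x^ k) t m           ∎
  ... | no m≰i = begin
    ι (i C m) * t ^ m                              ≈⟨ *-congʳ (reflexive (≡.cong ι iCm≡0)) ⟩
    0# * t ^ m                                     ≈⟨ zeroˡ _ ⟩
    0#                                             ≈⟨ linComb-x^-≰ i _ m≰i ⟨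
    linComb i (λ k → t ^ k * ι (i C k)) x^ m       ≈⟨ linComb-·P i (t ^_) _ x^ m ⟨
    eval i (λ k → ι (i C k) ·P x^ k) t m           ∎
    where iCm≡0 = k>n⇒nCk≡0 (ℕₚ.≰⇒> m≰i)

  ^P-binomial : ∀ a t i → ((x^ a +P (t ·P x^ (suc a))) ^P i) ≈P shift (i *ℕ a) (binomial i t)
  ^P-binomial a t zero      = oneP≈binomial-zero t
  ^P-binomial a t (suc i) n = begin
    (f *P (f ^P i)) n
      ≈⟨ *P-congˡ f (^P-binomial a t i) n ⟩
    (f *P S) n
      ≈⟨ *P-distribʳ S (x^ a) (t ·P x^ (suc a)) n ⟩
    (x^ a *P S) n + ((t ·P x^ (suc a)) *P S) n
      ≈⟨ +-cong (x^*P≈shift a S n) (trans (·P-*P-assoc t (x^ (suc a)) S n) (*-congˡ (x^*P≈shift (suc a) S n))) ⟩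
    shift a S n + t * shift (suc a) S n
      ≈⟨ +-cong (shift-shift a (i *ℕ a) B n)
                (*-congˡ (trans (shift-shift (suc a) (i *ℕ a) B n) (shift-suc (a +ℕ i *ℕ a) B n))) ⟩
    shift a′ B n + t * shift a′ (shift 1 B) n
      ≈⟨ trans (shift-+P a′ B (t ·P shift 1 B) n) (+-congˡ (shift-·P a′ t (shift 1 B) n)) ⟨
    shift a′ (B +P (t ·P shift 1 B)) n
      ≈⟨ shift-cong a′ (binomial-suc i t) n ⟨
    shift a′ (binomial (suc i) t) n
      ∎
    where
    f  = x^ a +P (t ·P x^ (suc a))
    B  = binomial i t
    S  = shift (i *ℕ a) B
    a′ = suc i *ℕ a

  powers∈⇒x^∈ : IsField → ∀ {w} {W : Pol → Set w} → IsSubspace W → ∀ {i} d → CharGreaterThan i →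
                (∀ f → DegLe d f → W (f ^P i)) → ∀ m → m ≤ i *ℕ d → W (x^ m)
  powers∈⇒x^∈ isField W-sub {i} zero char W[f^i] m m≤i*0
    with ℕₚ.n≤0⇒n≡0 (≡.subst (m ≤_) (ℕₚ.*-zeroʳ i) m≤i*0)
  ... | ≡.refl = IsSubspace.∈-resp W-sub (x^0-^P i) (W[f^i] (x^ 0) (DegLe-x^ 0))
  powers∈⇒x^∈ isField {W = W} W-sub {i} (suc d) char W[f^i] m m≤i*[1+d]
    with m≤n*[1+d]⇒m≡n*a+k i d m≤i*[1+d]
  ... | a , k , a≤d , k≤i , ≡.refl = IsSubspace.∈-resp W-sub (shift-x^ (i *ℕ a) k) W[x^ia*x^k]
    where
    V-sub = shift-preimage W-sub (i *ℕ a)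
    open IsSubspace V-sub

    coeff : ℕ → Pol
    coeff k = ι (i C k) ·P x^ k

    W[values] : ∀ s → s ≤ i → W (shift (i *ℕ a) (eval i coeff (ι s)))
    W[values] s _ = IsSubspace.∈-resp W-sub
      (≈P-trans (^P-binomial a (ι s) i) (shift-cong (i *ℕ a) (binomial≈eval i (ι s))))
      (W[f^i] _ (DegLe-mono (s≤s a≤d) (DegLe-x^+x^suc a (ι s))))

    W[coeff] : W (shift (i *ℕ a) (coeff k))
    W[coeff] = ∈-coefficients V-sub i coeff ι (ι-differences-invertible isField char) W[values] k k≤i

    W[x^ia*x^k] : W (shift (i *ℕ a) (x^ k))
    W[x^ia*x^k] =
      let y , yι≈1 = ≉0⇒invertible isField (ι[nCk]≉0 isField char k k≤i)
      in  ∈-resp (λ n → trans (sym (*-assoc _ _ _)) (trans (*-congʳ yι≈1) (*-identityˡ _))) (∈-·P y W[coeff])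

  module _ (i j d₁ d₂ : ℕ) where
    combo-++ : ∀ ts us → combo i j (ts ++ us) ≈P (combo i j ts +P combo i j us)
    combo-++ []                  us n = sym (+-identityˡ _)
    combo-++ ((a , f , g) ∷ ts) us n = trans (+-congˡ (combo-++ ts us n)) (sym (+-assoc _ _ _))

    AllDeg-++ : ∀ {ts us} → AllDeg d₁ d₂ ts → AllDeg d₁ d₂ us → AllDeg d₁ d₂ (ts ++ us)
    AllDeg-++ []           degs′ = degs′
    AllDeg-++ (deg ∷ degs) degs′ = deg ∷ AllDeg-++ degs degs′

    scaleTerm : Carrier → Carrier × Pol × Pol → Carrier × Pol × Pol
    scaleTerm a (b , fg) = a * b , fg

    combo-scale : ∀ a ts → combo i j (map (scaleTerm a) ts) ≈P (a ·P combo i j ts)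
    combo-scale a []                  n = sym (zeroʳ a)
    combo-scale a ((b , f , g) ∷ ts) n = trans (+-cong (*-assoc a b _) (combo-scale a ts n)) (sym (distribˡ _ _ _))

    AllDeg-scale : ∀ a {ts} → AllDeg d₁ d₂ ts → AllDeg d₁ d₂ (map (scaleTerm a) ts)
    AllDeg-scale a []           = []
    AllDeg-scale a (deg ∷ degs) = deg ∷ AllDeg-scale a degs

    InSpan-isSubspace : IsSubspace (InSpan i j d₁ d₂)
    InSpan-isSubspace = record
      { ∈-+P   = λ (ts , degs , p≈) (us , degs′ , q≈) →
                   ts ++ us , AllDeg-++ degs degs′ , λ n → trans (+-cong (p≈ n) (q≈ n)) (sym (combo-++ ts us n))
      ; ∈-·P   = λ a (ts , degs , p≈) →
                   map (scaleTerm a) ts , AllDeg-scale a degs , λ n → trans (*-congˡ (p≈ n)) (sym (combo-scale a ts n))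
      ; ∈-resp = λ p≈q (ts , degs , p≈) → ts , degs , λ n → trans (sym (p≈q n)) (p≈ n)
      }

    InSpan-generator : ∀ {f g} → DegLe d₁ f → DegLe d₂ g → InSpan i j d₁ d₂ ((f ^P i) *P (g ^P j))
    InSpan-generator {f} {g} deg-f deg-g =
      (1# , f , g) ∷ [] , (deg-f , deg-g) ∷ [] , λ n → sym (trans (+-identityʳ _) (*-identityˡ _))

    DegLe-combo : ∀ {ts} → AllDeg d₁ d₂ ts → DegLe (i *ℕ d₁ +ℕ j *ℕ d₂) (combo i j ts)
    DegLe-combo []                               n _ = refl
    DegLe-combo {(a , f , g) ∷ _} ((deg-f , deg-g) ∷ degs) =
      DegLe-+P (DegLe-·P a (DegLe-*P (DegLe-^P i deg-f) (DegLe-^P j deg-g))) (DegLe-combo degs)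

    x^∈InSpan : IsField → CharGreaterThan (i ⊔ j) →
                ∀ m → m ≤ i *ℕ d₁ +ℕ j *ℕ d₂ → InSpan i j d₁ d₂ (x^ m)
    x^∈InSpan isField char m m≤d =
      ≡.subst (InSpan i j d₁ d₂ ∘ x^) (ℕₚ.m⊓n+n∸m≡n (i *ℕ d₁) m)
        (IsSubspace.∈-resp span (≈P-trans (x^*P≈shift m₁ (x^ m₂)) (shift-x^ m₁ m₂)) W[x^m₁*x^m₂])
      where
      span = InSpan-isSubspace
      m₁ = i *ℕ d₁ ⊓ m
      m₂ = m ∸ i *ℕ d₁

      W[x^m₁*g^j] : ∀ g → DegLe d₂ g → InSpan i j d₁ d₂ (x^ m₁ *P (g ^P j))
      W[x^m₁*g^j] g deg-g =
        powers∈⇒x^∈ isField (*P-preimageʳ span (g ^P j)) d₁ (CharGreaterThan-mono (ℕₚ.m≤m⊔n i j) char)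
          (λ f deg-f → InSpan-generator deg-f deg-g) m₁ (ℕₚ.m⊓n≤m _ _)

      W[x^m₁*x^m₂] : InSpan i j d₁ d₂ (x^ m₁ *P x^ m₂)
      W[x^m₁*x^m₂] =
        powers∈⇒x^∈ isField (*P-preimageˡ span (x^ m₁)) d₂ (CharGreaterThan-mono (ℕₚ.m≤n⊔m i j) char)
          W[x^m₁*g^j] m₂ (ℕₚ.m≤n+o⇒m∸n≤o m (i *ℕ d₁) m≤d)

open import Data.Nat using (_+_; _*_)

lemma3p12 : {c ℓ : Level} (R : CommutativeRing c ℓ) → Poly.IsField R →
            (i j d₁ d₂ : ℕ) → Poly.CharGreaterThan R (i ⊔ j) →
            (h : Poly.Pol R) →
            (Poly.DegLe R (i * d₁ + j * d₂) h → Poly.InSpan R i j d₁ d₂ h)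
            × (Poly.InSpan R i j d₁ d₂ h → Poly.DegLe R (i * d₁ + j * d₂) h)
lemma3p12 R isField i j d₁ d₂ char h =
    x^∈⇒DegLe⇒∈ R (InSpan-isSubspace R i j d₁ d₂) (x^∈InSpan R i j d₁ d₂ isField char)
  , λ (ts , degs , h≈combo) → DegLe-resp R (≈P-sym R h≈combo) (DegLe-combo R i j d₁ d₂ degs)
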